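{- Let $F$ satisfy the standing assumptions below, let $G(x)=x$ and let $k$ be a positive integer. Define $$\mathscr{L}_k=\{p \text{ prime}: p\mid k\}\cup\left\{\frac{\ell(kp)}{\ell(k)}: p\text{ a pretty prime},\ p\nmid k\right\},\qquad \mathscr{Y}_k=\{\ell(k)\cdot m: m\in\mathcal N(\mathscr L_k)\},$$ where $\mathcal N(\mathscr L)=\{n\ge1: s\nmid n\text{ for all }s\in\mathscr L\}$. If $F$ is nice and $\mathscr{B}_{F,G,k}\neq\emptyset$, then $\#(\mathscr{B}_{F,G,k}\cap[1,x])\ge\#(\mathscr{Y}_k\cap[1,x])$ for all $x$. Moreover, if $F$ is nicer and $\mathscr{A}_{F,G,k}\neq\emptyset$, then $\#(\mathscr{A}_{F,G,k}\cap[1,x])\ge\#(\mathscr{Y}_k\cap[1,x])$ for all $x$.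
   Context: Standing assumptions: $F(X)\in\mathbb{Z}[X]$ has positive leading coefficient and degree at least $2$. Define $a_0=0$, $a_n=F(a_{n-1})$ for $n\ge1$; the sequence $(a_n)$ is assumed unbounded. For a positive integer $n$, $\mathfrak{o}(n)=\min\{r\ge1:n\mid a_r\}$ if it exists and $\infty$ otherwise; $n$ is pretty if $\mathfrak{o}(n)<\infty$; $\ell(n)=\mathrm{lcm}(n,\mathfrak{o}(n))$ if $n$ is pretty and $\ell(n)=\infty$ otherwise. $\mathscr{B}_{F,G,k}$ is the set of positive integers $n$ with $k\mid\gcd(G(n),a_n)$ such that every prime dividing $\gcd(G(n),a_n)$ divides $k$; $\mathscr{A}_{F,G,k}=\{n\ge1:\gcd(G(n),a_n)=k\}$. $F$ is nice if $\sum_{p\text{ prime},\,p\mid a_p}1/p<\infty$; nicer if nice and its coefficient of $X^1$ is zero. -}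

module Defs where

open import Data.Nat as ℕ using (ℕ; zero; suc; _≤_; _<_)
open import Data.Nat.Divisibility using (_∣_; _∣?_)
open import Data.Nat.GCD using (gcd)
open import Data.Nat.LCM using (lcm)
open import Data.Nat.Primality using (Prime; prime?)
open import Data.Integer as ℤ using (ℤ; +_; ∣_∣)
open import Data.Rational.Unnormalised as Q using (ℚᵘ; mkℚᵘ; 0ℚᵘ)
open import Data.List using (List; []; _∷_; _++_; length)
open import Data.List.Relation.Unary.All using (All)
open import Data.List.Relation.Unary.Unique.Propositional using (Unique)
open import Data.Product using (Σ; ∃; _×_; _,_)
open import Data.Bool using (if_then_else_; _∧_)
open import Relation.Nullary using (¬_; does)
open import Relation.Binary.PropositionalEquality using (_≡_)

-- A polynomial F(X) = c₀ + c₁X + … + c_{d-1}X^{d-1} + lead·X^d with d = length low.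
record Poly : Set where
  constructor poly
  field
    low  : List ℤ
    lead : ℤ
open Poly public

coeffList : Poly → List ℤ
coeffList F = low F ++ (lead F ∷ [])

evalL : List ℤ → ℤ → ℤ
evalL []       x = + 0
evalL (c ∷ cs) x = c ℤ.+ x ℤ.* evalL cs x

eval : Poly → ℤ → ℤ
eval F = evalL (coeffList F)

coeffAt : List ℤ → ℕ → ℤ
coeffAt []       i       = + 0
coeffAt (c ∷ cs) zero    = c
coeffAt (c ∷ cs) (suc i) = coeffAt cs i

coeff : Poly → ℕ → ℤ
coeff F = coeffAt (coeffList F)

degree : Poly → ℕ
degree F = length (low F)

seqA : Poly → ℕ → ℤ
seqA F zero    = + 0
seqA F (suc n) = eval F (seqA F n)

Unbounded : Poly → Set
Unbounded F = (B : ℕ) → ∃ λ n → B < ∣ seqA F n ∣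

StandingAssumptions : Poly → Set
StandingAssumptions F = (+ 0 ℤ.< lead F) × (2 ≤ degree F) × Unbounded F

Divs : Poly → ℕ → ℕ → Set
Divs F n r = n ∣ ∣ seqA F r ∣

IsOrd : Poly → ℕ → ℕ → Set
IsOrd F n r = (1 ≤ r) × Divs F n r × ((s : ℕ) → 1 ≤ s → s < r → ¬ Divs F n s)

Pretty : Poly → ℕ → Set
Pretty F n = ∃ λ r → (1 ≤ r) × Divs F n r

IsEll : Poly → ℕ → ℕ → Set
IsEll F n L = ∃ λ r → IsOrd F n r × (L ≡ lcm n r)

recip : ℕ → ℚᵘ
recip zero    = 0ℚᵘ
recip (suc n) = mkℚᵘ (+ 1) n

niceTerm : Poly → ℕ → ℚᵘ
niceTerm F p = if does (prime? p) ∧ does (p ∣? ∣ seqA F p ∣) then recip p else 0ℚᵘ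

nicePartial : Poly → ℕ → ℚᵘ
nicePartial F zero    = 0ℚᵘ
nicePartial F (suc N) = nicePartial F N Q.+ niceTerm F N

Nice : Poly → Set
Nice F = ∃ λ (B : ℚᵘ) → (N : ℕ) → nicePartial F N Q.≤ B

Nicer : Poly → Set
Nicer F = Nice F × (coeff F 1 ≡ + 0)

-- G(x) = x, so gcd(G(n), a_n) = gcd(n, |a_n|)
gcdGA : Poly → ℕ → ℕ
gcdGA F n = gcd n ∣ seqA F n ∣

InB : Poly → ℕ → ℕ → Set
InB F k n = (1 ≤ n) × (k ∣ gcdGA F n) × ((q : ℕ) → Prime q → q ∣ gcdGA F n → q ∣ k)

InA : Poly → ℕ → ℕ → Set
InA F k n = (1 ≤ n) × (gcdGA F n ≡ k)

-- m ∈ 𝒩(𝓛_k): no element of 𝓛_k divides m.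
-- Elements of 𝓛_k: primes q ∣ k, and ℓ(kp)/ℓ(k) for pretty primes p ∤ k
-- (the quotient d is characterised by ℓ(kp) = d · ℓ(k)).
InNL : Poly → ℕ → ℕ → Set
InNL F k m =
  (1 ≤ m)
  × ((q : ℕ) → Prime q → q ∣ k → ¬ q ∣ m)
  × ((p : ℕ) → Prime p → Pretty F p → ¬ p ∣ k →
     (L L' d : ℕ) → IsEll F k L → IsEll F (k ℕ.* p) L' → L' ≡ d ℕ.* L → ¬ d ∣ m)

InY : Poly → ℕ → ℕ → Set
InY F k y = ∃ λ L → ∃ λ m → IsEll F k L × InNL F k m × (y ≡ L ℕ.* m)

-- #(S ∩ [1,x]) ≥ #(T ∩ [1,x]): every duplicate-free list of elements of T ∩ [1,x]
-- is matched by a duplicate-free list of elements of S ∩ [1,x] at least as long.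
InRange : ℕ → ℕ → Set
InRange x n = (1 ≤ n) × (n ≤ x)

CountGE : (ℕ → Set) → (ℕ → Set) → Set
CountGE S T = (x : ℕ) (ys : List ℕ) → Unique ys → All (λ y → InRange x y × T y) ys →
  ∃ λ (bs : List ℕ) → Unique bs × All (λ b → InRange x b × S b) bs × (length ys ≤ length bs)

NonEmpty : (ℕ → Set) → Set
NonEmpty S = ∃ λ n → S n

-- Since F has integer coefficients and a₀ = 0, once k ∣ a_r the residues of (aₙ) modulo k
-- repeat with period r, so k ∣ aₙ exactly when 𝔬(k) ∣ n, and ℓ(k) ∣ n exactly when
-- k ∣ gcd(n, aₙ).
-- For y = ℓ(k)·m with m ∈ 𝒩(𝓛ₖ) this gives k ∣ gcd(y, a_y); a prime q ∤ k dividing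
-- gcd(y, a_y) would be pretty with ℓ(kq) ∣ y, forcing ℓ(kq)/ℓ(k) ∣ m.  Hence 𝒴ₖ ⊆ ℬ.
-- If moreover F has no linear term, then F(x) ≡ F(0) mod x², so a_{j𝔬} ≡ a_𝔬 mod a_𝔬²
-- with 𝔬 = 𝔬(k); the cofactor a_{j𝔬}/a_𝔬 is then coprime to a_𝔬, and gcd(y, a_y) divides
-- gcd(ℓ(k), a_𝔬), which divides gcd(n₀, a_{n₀}) = k for any n₀ ∈ 𝒜.  Hence 𝒴ₖ ⊆ 𝒜.
module Submission where

open import Defs
open import Data.Nat using (ℕ; zero; suc; _+_; _*_; _≤_; _<_; _≤?_; s≤s; z≤n; >-nonZero)
import Data.Nat.Properties as ℕ
open import Data.Nat.Divisibility
  using (_∣_; divides; _∣?_; ∣-refl; ∣-trans; ∣-antisym; *-cancelʳ-∣; ∣1⇒≡1; m∣m*n; 0∣⇒≡0; m%n≡0⇒n∣m)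
open import Data.Nat.DivMod using (_/_; _%_; m≡m%n+[m/n]*n; m%n<n)
open import Data.Nat.GCD using (gcd; gcd[m,n]∣m; gcd[m,n]∣n; gcd-greatest)
open import Data.Nat.LCM using (lcm; m∣lcm[m,n]; n∣lcm[m,n]; lcm-least; gcd*lcm)
open import Data.Nat.Coprimality using (Coprime; coprime-divisor)
open import Data.Nat.Primality using (Prime; prime[2]; ¬prime[1]; prime⇒irreducible)
open import Data.Nat.Primality.Factorisation using (factorise; PrimeFactorisation)
open import Data.Nat.ListAction using (product)
open import Data.Nat.GeneralisedArithmetic using (fold; fold-+)
open import Data.Nat.Induction using (<-rec)
open import Data.Nat.Tactic.RingSolver using () renaming (solve-∀ to solveℕ)
open import Data.Integer as ℤ using (ℤ; +_; ∣_∣)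
import Data.Integer.Properties as ℤᵖ
open import Data.Integer.Divisibility.Signed as ℤ∣ using () renaming (_∣_ to _∣ℤ_)
open import Data.Integer.Tactic.RingSolver using (solve-∀)
open import Data.List using ([]; _∷_)
open import Data.List.Relation.Unary.All as All using (_∷_)
open import Data.Product using (∃; _×_; _,_; proj₁; proj₂)
open import Data.Sum using (inj₁; inj₂)
open import Data.Empty using (⊥-elim)
open import Relation.Nullary using (¬_; yes; no; _×-dec_)
open import Relation.Unary using (Decidable)
open import Relation.Binary.PropositionalEquality using (_≡_; refl; sym; trans; cong; subst; subst₂)
open Relation.Binary.PropositionalEquality.≡-Reasoning

infix 4 _≡_mod_

-- A record rather than a plain abbreviation, so that x, y and M can be inferred from the type.
record _≡_mod_ (x y M : ℤ) : Set where
  constructor ≡mod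
  field modulus∣difference : M ∣ℤ x ℤ.- y

≡mod-refl : ∀ {M} x → x ≡ x mod M
≡mod-refl {M} x = ≡mod (ℤ∣.divides (+ 0) (trans (ℤᵖ.+-inverseʳ x) (sym (ℤᵖ.*-zeroˡ M))))

≡mod-sym : ∀ {M x y} → x ≡ y mod M → y ≡ x mod M
≡mod-sym {x = x} {y} (≡mod M∣x-y) = ≡mod (subst (_ ∣ℤ_) (identity x y) (ℤ∣.∣m⇒∣-m M∣x-y))
  where
  identity : ∀ x y → ℤ.- (x ℤ.- y) ≡ y ℤ.- x
  identity = solve-∀

≡mod-trans : ∀ {M x y z} → x ≡ y mod M → y ≡ z mod M → x ≡ z mod M
≡mod-trans {x = x} {y} {z} (≡mod M∣x-y) (≡mod M∣y-z) =
  ≡mod (subst (_ ∣ℤ_) (identity x y z) (ℤ∣.∣m∣n⇒∣m+n M∣x-y M∣y-z))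
  where
  identity : ∀ x y z → (x ℤ.- y) ℤ.+ (y ℤ.- z) ≡ x ℤ.- z
  identity = solve-∀

≡mod-+ : ∀ {M a b c d} → a ≡ b mod M → c ≡ d mod M → a ℤ.+ c ≡ b ℤ.+ d mod M
≡mod-+ {a = a} {b} {c} {d} (≡mod M∣a-b) (≡mod M∣c-d) =
  ≡mod (subst (_ ∣ℤ_) (identity a b c d) (ℤ∣.∣m∣n⇒∣m+n M∣a-b M∣c-d))
  where
  identity : ∀ a b c d → (a ℤ.- b) ℤ.+ (c ℤ.- d) ≡ (a ℤ.+ c) ℤ.- (b ℤ.+ d)
  identity = solve-∀

≡mod-* : ∀ {M a b c d} → a ≡ b mod M → c ≡ d mod M → a ℤ.* c ≡ b ℤ.* d mod M
≡mod-* {a = a} {b} {c} {d} (≡mod M∣a-b) (≡mod M∣c-d) =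
  ≡mod (subst (_ ∣ℤ_) (identity a b c d)
    (ℤ∣.∣m∣n⇒∣m+n (ℤ∣.∣n⇒∣m*n a M∣c-d) (ℤ∣.∣m⇒∣m*n d M∣a-b)))
  where
  identity : ∀ a b c d → a ℤ.* (c ℤ.- d) ℤ.+ (a ℤ.- b) ℤ.* d ≡ a ℤ.* c ℤ.- b ℤ.* d
  identity = solve-∀

∣⇒≡0-mod : ∀ {M x} → M ∣ℤ x → x ≡ + 0 mod M
∣⇒≡0-mod {M} {x} M∣x = ≡mod (subst (M ∣ℤ_) (sym (ℤᵖ.+-identityʳ x)) M∣x)

≡mod-∣ : ∀ {M x y} → x ≡ y mod M → M ∣ℤ y → M ∣ℤ x
≡mod-∣ {x = x} {y} (≡mod M∣x-y) M∣y = subst (_ ∣ℤ_) (identity x y) (ℤ∣.∣m∣n⇒∣m+n M∣x-y M∣y)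
  where
  identity : ∀ x y → (x ℤ.- y) ℤ.+ y ≡ x
  identity = solve-∀

evalL-≡mod : ∀ {M x y} cs → x ≡ y mod M → evalL cs x ≡ evalL cs y mod M
evalL-≡mod []       x≡y = ≡mod-refl (+ 0)
evalL-≡mod (c ∷ cs) x≡y = ≡mod-+ (≡mod-refl c) (≡mod-* x≡y (evalL-≡mod cs x≡y))

fold-≡mod : ∀ {M} (f : ℤ → ℤ) → (∀ {x y} → x ≡ y mod M → f x ≡ f y mod M) →
            ∀ {x y} n → x ≡ y mod M → fold x f n ≡ fold y f n mod M
fold-≡mod f f-cong zero    x≡y = x≡y
fold-≡mod f f-cong (suc n) x≡y = f-cong (fold-≡mod f f-cong n x≡y)

seqA≡fold : ∀ F n → seqA F n ≡ fold (+ 0) (eval F) n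
seqA≡fold F zero    = refl
seqA≡fold F (suc n) = cong (eval F) (seqA≡fold F n)

seqA-+ : ∀ F s r → seqA F (s + r) ≡ fold (seqA F r) (eval F) s
seqA-+ F s r = begin
  seqA F (s + r)                         ≡⟨ seqA≡fold F (s + r) ⟩
  fold (+ 0) (eval F) (s + r)            ≡⟨ fold-+ (+ 0) (eval F) s ⟩
  fold (fold (+ 0) (eval F) r) (eval F) s ≡⟨ cong (λ z → fold z (eval F) s) (sym (seqA≡fold F r)) ⟩
  fold (seqA F r) (eval F) s             ∎

eval-≡mod : ∀ {M x y} F → x ≡ y mod M → eval F x ≡ eval F y mod M
eval-≡mod F = evalL-≡mod (coeffList F)

seqA-+-≡mod : ∀ {M} F s {r r′} → seqA F r ≡ seqA F r′ mod M →
              seqA F (s + r) ≡ seqA F (s + r′) mod M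
seqA-+-≡mod F s {r} {r′} a_r≡a_r′ =
  subst₂ (_≡_mod _) (sym (seqA-+ F s r)) (sym (seqA-+ F s r′))
    (fold-≡mod (eval F) (eval-≡mod F) s a_r≡a_r′)

∣seqA⇒seqA-periodic : ∀ {M} F {r} → M ∣ℤ seqA F r → ∀ s → seqA F (s + r) ≡ seqA F s mod M
∣seqA⇒seqA-periodic {M} F {r} M∣a_r s =
  subst (λ t → seqA F (s + r) ≡ seqA F t mod M) (ℕ.+-identityʳ s)
    (seqA-+-≡mod F s {r} {0} (∣⇒≡0-mod M∣a_r))

∣seqA⇒∣seqA-multiple : ∀ {M} F {r} → M ∣ℤ seqA F r → ∀ j → M ∣ℤ seqA F (j * r)
∣seqA⇒∣seqA-multiple {M} F {r} M∣a_r zero    = ℤ∣.divides (+ 0) (sym (ℤᵖ.*-zeroˡ M))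
∣seqA⇒∣seqA-multiple {M} F {r} M∣a_r (suc j) =
  subst (λ t → M ∣ℤ seqA F t) (ℕ.+-comm (j * r) r)
    (≡mod-∣ (∣seqA⇒seqA-periodic F M∣a_r (j * r)) (∣seqA⇒∣seqA-multiple F M∣a_r j))

Divs-multiple : ∀ {F k r n} → Divs F k r → r ∣ n → Divs F k n
Divs-multiple {F} {k} k∣a_r (divides j refl) =
  ℤ∣.∣⇒∣ᵤ (∣seqA⇒∣seqA-multiple F (ℤ∣.∣ᵤ⇒∣ {+ k} k∣a_r) j)

Divs-+-cancelʳ : ∀ {F k r} s → Divs F k r → Divs F k (s + r) → Divs F k s
Divs-+-cancelʳ {F} {k} s k∣a_r k∣a_s+r = ℤ∣.∣⇒∣ᵤ
  (≡mod-∣ (≡mod-sym (∣seqA⇒seqA-periodic F (ℤ∣.∣ᵤ⇒∣ {+ k} k∣a_r) s)) (ℤ∣.∣ᵤ⇒∣ {+ k} k∣a_s+r))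

Divs⇒ord∣ : ∀ {F k o n} → IsOrd F k o → Divs F k n → o ∣ n
Divs⇒ord∣ {F} {k} {suc o′} {n} (_ , k∣a_o , below-o) k∣a_n = m%n≡0⇒n∣m n (suc o′) remainder≡0
  where
  k∣a_remainder : Divs F k (n % suc o′)
  k∣a_remainder = Divs-+-cancelʳ (n % suc o′)
    (Divs-multiple {r = suc o′} k∣a_o (divides (n / suc o′) refl))
    (subst (Divs F k) (m≡m%n+[m/n]*n n (suc o′)) k∣a_n)
  remainder≡0 : n % suc o′ ≡ 0
  remainder≡0 with n % suc o′ | k∣a_remainder | m%n<n n (suc o′)
  ... | zero  | _      | _   = refl
  ... | suc ρ | k∣a_ρ | ρ<o = ⊥-elim (below-o (suc ρ) (s≤s z≤n) ρ<o k∣a_ρ)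

IsLeastPositive : (ℕ → Set) → ℕ → Set
IsLeastPositive P r = (1 ≤ r) × P r × (∀ s → 1 ≤ s → s < r → ¬ P s)

module _ {P : ℕ → Set} (P? : Decidable P) where

  leastPositive : ∀ n → 1 ≤ n → P n → ∃ (IsLeastPositive P)
  leastPositive = <-rec _ step
    where
    step : ∀ n → (∀ {s} → s < n → 1 ≤ s → P s → ∃ (IsLeastPositive P)) →
           1 ≤ n → P n → ∃ (IsLeastPositive P)
    step n smaller 1≤n Pn with ℕ.anyUpTo? (λ s → (1 ≤? s) ×-dec P? s) n
    ... | yes (s , s<n , 1≤s , Ps) = smaller s<n 1≤s Ps
    ... | no  none-below           = n , 1≤n , Pn , λ s 1≤s s<n Ps → none-below (s , s<n , 1≤s , Ps)

ell-exists : ∀ {F n} → Pretty F n → ∃ (IsEll F n)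
ell-exists {F} {n} (r , 1≤r , n∣a_r) with leastPositive (λ r → n ∣? ∣ seqA F r ∣) r 1≤r n∣a_r
... | o , ord = lcm n o , o , ord , refl

ell-positive : ∀ {F k L} → 1 ≤ k → IsEll F k L → 1 ≤ L
ell-positive {k = k} 1≤k (o , (1≤o , _) , refl) = ℕ.n≢0⇒n>0 λ lcm≡0 →
  ℕ.<⇒≢ (ℕ.*-mono-≤ 1≤k 1≤o) (begin
    0                 ≡⟨ ℕ.*-zeroʳ (gcd k o) ⟨
    gcd k o * 0       ≡⟨ cong (gcd k o *_) lcm≡0 ⟨
    gcd k o * lcm k o ≡⟨ gcd*lcm k o ⟩
    k * o             ∎)

gcdGA∣n : ∀ F n → gcdGA F n ∣ n
gcdGA∣n F n = gcd[m,n]∣m n ∣ seqA F n ∣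

gcdGA∣a : ∀ F n → gcdGA F n ∣ ∣ seqA F n ∣
gcdGA∣a F n = gcd[m,n]∣n n ∣ seqA F n ∣

ell∣⇒∣gcd : ∀ {F k L n} → IsEll F k L → L ∣ n → k ∣ gcdGA F n
ell∣⇒∣gcd {k = k} (o , (_ , k∣a_o , _) , refl) L∣n =
  gcd-greatest (∣-trans (m∣lcm[m,n] k o) L∣n) (Divs-multiple k∣a_o (∣-trans (n∣lcm[m,n] k o) L∣n))

∣gcd⇒ell∣ : ∀ {F k L n} → IsEll F k L → k ∣ gcdGA F n → L ∣ n
∣gcd⇒ell∣ {F} {n = n} (o , ord , refl) k∣g =
  lcm-least (∣-trans k∣g (gcdGA∣n F n)) (Divs⇒ord∣ ord (∣-trans k∣g (gcdGA∣a F n)))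

prime∤⇒coprime : ∀ {q k} → Prime q → ¬ q ∣ k → Coprime q k
prime∤⇒coprime q-prime q∤k (d∣q , d∣k) with prime⇒irreducible q-prime d∣q
... | inj₁ d≡1  = d≡1
... | inj₂ refl = ⊥-elim (q∤k d∣k)

coprime⇒*∣ : ∀ {q k n} → Coprime q k → k ∣ n → q ∣ n → k * q ∣ n
coprime⇒*∣ {q} {k} coprime (divides t refl) q∣tk
  with coprime-divisor coprime (subst (q ∣_) (ℕ.*-comm t k) q∣tk)
... | divides u refl = divides u (identity u q k)
  where
  identity : ∀ u q k → u * q * k ≡ u * (k * q)
  identity = solveℕ

noCommonPrime⇒coprime : ∀ {m n} → (∀ {p} → Prime p → p ∣ m → ¬ p ∣ n) → Coprime m n
noCommonPrime⇒coprime {m} {n} disjoint {zero} (0∣m , 0∣n)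
  with 0∣⇒≡0 0∣m | 0∣⇒≡0 0∣n
... | refl | refl = ⊥-elim (disjoint prime[2] (divides 0 refl) (divides 0 refl))
noCommonPrime⇒coprime {m} {n} disjoint {d@(suc _)} (d∣m , d∣n) = noPrimeFactor (factorise d)
  where
  noPrimeFactor : PrimeFactorisation d → d ≡ 1
  noPrimeFactor f with PrimeFactorisation.factors f | PrimeFactorisation.isFactorisation f
                     | PrimeFactorisation.factorsPrime f
  ... | []     | d≡1   | _ = d≡1
  ... | p ∷ ps | d≡p*ps | p-prime ∷ _ = ⊥-elim (disjoint p-prime (∣-trans p∣d d∣m) (∣-trans p∣d d∣n))
    where
    p∣d : p ∣ d
    p∣d = divides (product ps) (trans d≡p*ps (ℕ.*-comm p (product ps)))

evalL-≡mod-square : ∀ cs → coeffAt cs 1 ≡ + 0 → ∀ x → evalL cs x ≡ evalL cs (+ 0) mod x ℤ.* x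
evalL-≡mod-square []                _    x = ≡mod-refl (+ 0)
evalL-≡mod-square (c ∷ [])          _    x = ≡mod (ℤ∣.divides (+ 0) (identity c x))
  where
  identity : ∀ c x → (c ℤ.+ x ℤ.* + 0) ℤ.- (c ℤ.+ + 0 ℤ.* + 0) ≡ + 0 ℤ.* (x ℤ.* x)
  identity = solve-∀
evalL-≡mod-square (c ∷ .(+ 0) ∷ cs) refl x =
  ≡mod (ℤ∣.divides (evalL cs x) (identity c x (evalL cs x) (evalL cs (+ 0))))
  where
  identity : ∀ c x e e₀ →
    (c ℤ.+ x ℤ.* (+ 0 ℤ.+ x ℤ.* e)) ℤ.- (c ℤ.+ + 0 ℤ.* (+ 0 ℤ.+ + 0 ℤ.* e₀)) ≡ e ℤ.* (x ℤ.* x)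
  identity = solve-∀

seqA-suc-+-≡mod-square : ∀ F → coeff F 1 ≡ + 0 → ∀ s r →
  seqA F (suc s + r) ≡ seqA F (suc s) mod seqA F r ℤ.* seqA F r
seqA-suc-+-≡mod-square F c₁≡0 s r =
  subst₂ (λ t u → seqA F t ≡ seqA F u mod seqA F r ℤ.* seqA F r) (ℕ.+-suc s r) (ℕ.+-comm s 1)
    (seqA-+-≡mod F s {suc r} {1} (evalL-≡mod-square (coeffList F) c₁≡0 (seqA F r)))

seqA-multiple-≡mod-square : ∀ F → coeff F 1 ≡ + 0 → ∀ o j →
  seqA F (j * suc o + suc o) ≡ seqA F (suc o) mod seqA F (suc o) ℤ.* seqA F (suc o)
seqA-multiple-≡mod-square F c₁≡0 o zero    = ≡mod-refl (seqA F (suc o))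
seqA-multiple-≡mod-square F c₁≡0 o (suc j) = ≡mod-trans
  (seqA-suc-+-≡mod-square F c₁≡0 (o + j * suc o) (suc o))
  (subst (λ t → seqA F t ≡ seqA F (suc o) mod seqA F (suc o) ℤ.* seqA F (suc o))
    (ℕ.+-comm (j * suc o) (suc o))
    (seqA-multiple-≡mod-square F c₁≡0 o j))

≡mod-square⇒factor : ∀ {x a} → x ≡ a mod a ℤ.* a → ∃ λ t → x ≡ (+ 1 ℤ.+ t ℤ.* a) ℤ.* a
≡mod-square⇒factor {x} {a} (≡mod (ℤ∣.divides t x-a≡taa)) = t , (begin
  x                         ≡⟨ identity₁ x a ⟩
  (x ℤ.- a) ℤ.+ a           ≡⟨ cong (ℤ._+ a) x-a≡taa ⟩
  t ℤ.* (a ℤ.* a) ℤ.+ a     ≡⟨ identity₂ t a ⟩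
  (+ 1 ℤ.+ t ℤ.* a) ℤ.* a   ∎)
  where
  identity₁ : ∀ x a → x ≡ (x ℤ.- a) ℤ.+ a
  identity₁ = solve-∀
  identity₂ : ∀ t a → t ℤ.* (a ℤ.* a) ℤ.+ a ≡ (+ 1 ℤ.+ t ℤ.* a) ℤ.* a
  identity₂ = solve-∀

prime∣a⇒∤1+t*a : ∀ {p} → Prime p → ∀ {a} t → p ∣ ∣ a ∣ → ¬ p ∣ ∣ + 1 ℤ.+ t ℤ.* a ∣
prime∣a⇒∤1+t*a {p} p-prime {a} t p∣a p∣1+ta = ¬prime[1] (subst Prime (∣1⇒≡1 p∣1) p-prime)
  where
  p∣1 : p ∣ 1
  p∣1 = ℤ∣.∣⇒∣ᵤ (ℤ∣.∣m+n∣n⇒∣m {m = + 1} {t ℤ.* a}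
    (ℤ∣.∣ᵤ⇒∣ {+ p} p∣1+ta) (ℤ∣.∣n⇒∣m*n t (ℤ∣.∣ᵤ⇒∣ {+ p} p∣a)))

∣seqA-multiple⇒∣seqA : ∀ F → coeff F 1 ≡ + 0 → ∀ {g r n} → 1 ≤ r → 1 ≤ n → r ∣ n →
  (∀ {p} → Prime p → p ∣ g → p ∣ ∣ seqA F r ∣) → g ∣ ∣ seqA F n ∣ → g ∣ ∣ seqA F r ∣
∣seqA-multiple⇒∣seqA F c₁≡0 {r = zero}  ()
∣seqA-multiple⇒∣seqA F c₁≡0 {r = suc o} _ () (divides zero refl)
∣seqA-multiple⇒∣seqA F c₁≡0 {g} {suc o} _ _ (divides (suc j) refl) primeFactor∣a g∣a_n
  with ≡mod-square⇒factor (seqA-multiple-≡mod-square F c₁≡0 o j)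
... | t , a_n≡[1+ta]a = coprime-divisor coprime (subst (g ∣_) |a_n|≡ g∣a_n)
  where
  a : ℤ
  a = seqA F (suc o)
  coprime : Coprime g ∣ + 1 ℤ.+ t ℤ.* a ∣
  coprime = noCommonPrime⇒coprime λ p-prime p∣g →
    prime∣a⇒∤1+t*a p-prime t (primeFactor∣a p-prime p∣g)
  |a_n|≡ : ∣ seqA F (suc j * suc o) ∣ ≡ ∣ + 1 ℤ.+ t ℤ.* a ∣ * ∣ a ∣
  |a_n|≡ = begin
    ∣ seqA F (suc o + j * suc o) ∣     ≡⟨ cong (λ i → ∣ seqA F i ∣) (ℕ.+-comm (suc o) (j * suc o)) ⟩
    ∣ seqA F (j * suc o + suc o) ∣     ≡⟨ cong ∣_∣ a_n≡[1+ta]a ⟩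
    ∣ (+ 1 ℤ.+ t ℤ.* a) ℤ.* a ∣       ≡⟨ ℤᵖ.abs-* (+ 1 ℤ.+ t ℤ.* a) a ⟩
    ∣ + 1 ℤ.+ t ℤ.* a ∣ * ∣ a ∣        ∎

InY⊆InB : ∀ {F k y} → 1 ≤ k → InY F k y → InB F k y
InY⊆InB {F} {k} 1≤k (L , m , ell , (1≤m , _ , ell-quotient∤m) , refl) = 1≤y , k∣g , primeFactor∣k
  where
  1≤L : 1 ≤ L
  1≤L = ell-positive 1≤k ell
  1≤y : 1 ≤ L * m
  1≤y = ℕ.*-mono-≤ 1≤L 1≤m
  k∣g : k ∣ gcdGA F (L * m)
  k∣g = ell∣⇒∣gcd ell (m∣m*n m)
  primeFactor∣k : (q : ℕ) → Prime q → q ∣ gcdGA F (L * m) → q ∣ k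
  primeFactor∣k q q-prime q∣g with q ∣? k
  ... | yes q∣k = q∣k
  ... | no  q∤k = ⊥-elim (ell-quotient∤m q q-prime q-pretty q∤k L L′ d ell ell′ L′≡dL d∣m)
    where
    q-pretty : Pretty F q
    q-pretty = L * m , 1≤y , ∣-trans q∣g (gcdGA∣a F (L * m))
    kq∣g : k * q ∣ gcdGA F (L * m)
    kq∣g = coprime⇒*∣ (prime∤⇒coprime q-prime q∤k) k∣g q∣g
    ellkq : ∃ (IsEll F (k * q))
    ellkq = ell-exists {F} {k * q} (L * m , 1≤y , ∣-trans kq∣g (gcdGA∣a F (L * m)))
    L′ : ℕ
    L′ = proj₁ ellkq
    ell′ : IsEll F (k * q) L′
    ell′ = proj₂ ellkq
    L∣L′ : L ∣ L′
    L∣L′ = ∣gcd⇒ell∣ ell (∣-trans (m∣m*n q) (ell∣⇒∣gcd ell′ ∣-refl))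
    d : ℕ
    d = _∣_.quotient L∣L′
    L′≡dL : L′ ≡ d * L
    L′≡dL = _∣_.equality L∣L′
    d∣m : d ∣ m
    d∣m = *-cancelʳ-∣ L {{>-nonZero 1≤L}}
      (subst₂ _∣_ L′≡dL (ℕ.*-comm L m) (∣gcd⇒ell∣ ell′ kq∣g))

InY⊆InA : ∀ {F k y} → 1 ≤ k → coeff F 1 ≡ + 0 → NonEmpty (InA F k) → InY F k y → InA F k y
InY⊆InA {F} {k} 1≤k c₁≡0 (n₀ , _ , g₀≡k)
  y∈Y@(L , m , ell@(o , (1≤o , k∣a_o , _) , refl) , (_ , q∣k⇒q∤m , _) , refl)
  with InY⊆InB 1≤k y∈Y
... | 1≤y , k∣g , primeFactor∣k = 1≤y , ∣-antisym g∣k k∣g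
  where
  y : ℕ
  y = lcm k o * m
  g : ℕ
  g = gcdGA F y
  g∣L : g ∣ lcm k o
  g∣L = coprime-divisor
    (noCommonPrime⇒coprime λ p-prime p∣g → q∣k⇒q∤m _ p-prime (primeFactor∣k _ p-prime p∣g))
    (subst (g ∣_) (ℕ.*-comm (lcm k o) m) (gcdGA∣n F y))
  g∣a_o : g ∣ ∣ seqA F o ∣
  g∣a_o = ∣seqA-multiple⇒∣seqA F c₁≡0 1≤o 1≤y (∣-trans (n∣lcm[m,n] k o) (m∣m*n m))
    (λ p-prime p∣g → ∣-trans (primeFactor∣k _ p-prime p∣g) k∣a_o) (gcdGA∣a F y)
  L∣n₀ : lcm k o ∣ n₀
  L∣n₀ = ∣gcd⇒ell∣ ell (subst (k ∣_) (sym g₀≡k) ∣-refl)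
  a_o∣a_n₀ : ∣ seqA F o ∣ ∣ ∣ seqA F n₀ ∣
  a_o∣a_n₀ = Divs-multiple {F} {∣ seqA F o ∣} {o} ∣-refl (∣-trans (n∣lcm[m,n] k o) L∣n₀)
  g∣k : g ∣ k
  g∣k = subst (g ∣_) g₀≡k (gcd-greatest (∣-trans g∣L L∣n₀) (∣-trans g∣a_o a_o∣a_n₀))

CountGE-⊆ : ∀ {S T} → (∀ {y} → T y → S y) → CountGE S T
CountGE-⊆ T⊆S x ys unique ys⊆T∩[1,x] =
  ys , unique , All.map (λ (y∈[1,x] , y∈T) → y∈[1,x] , T⊆S y∈T) ys⊆T∩[1,x] , ℕ.≤-refl

lemma4p1 : (F : Poly) → StandingAssumptions F → (k : ℕ) → 1 ≤ k →
    ((Nice F → NonEmpty (InB F k) → CountGE (InB F k) (InY F k))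
     × (Nicer F → NonEmpty (InA F k) → CountGE (InA F k) (InY F k)))
lemma4p1 F _ k 1≤k =
  (λ _ _ → CountGE-⊆ (InY⊆InB 1≤k)) ,
  (λ (_ , c₁≡0) 𝒜≠∅ → CountGE-⊆ (InY⊆InA 1≤k c₁≡0 𝒜≠∅))
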